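{- Let $P$ be a finite ordered set with at least $3$ points, let $A\subseteq P$ be an antichain that does not contain any nontrivial order-autonomous antichain of $P$, and let $\Phi,\Psi\in\mathrm{Aut}(P)$ be such that both $\Phi$ and $\Psi$ map $A$ to itself and $\Phi|_{P\setminus A}=\Psi|_{P\setminus A}$. Then $\Phi=\Psi$.
   Context: A nonempty $B\subseteq P$ is order-autonomous if for every $z\in P\setminus B$: $z<b$ for some $b\in B$ implies $z<b'$ for all $b'\in B$, and $z>b$ for some $b\in B$ implies $z>b'$ for all $b'\in B$; it is nontrivial if $|B|\notin\{1,|P|\}$. -}

module Defs where

open import Level using (Level)
open import Data.Nat using (ℕ)
open import Data.Fin using (Fin)
open import Data.Fin.Subset using (Subset; _∈_; _∉_; _⊆_; ∣_∣)
open import Data.Product using (Σ; ∃; _×_; _,_)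
open import Relation.Binary.PropositionalEquality using (_≡_; _≢_)
open import Relation.Binary.Definitions using (Decidable)
open import Relation.Binary.Structures using (IsPartialOrder)
open import Relation.Nullary using (¬_)
open import Function.Bundles using (Bijection)

record FinPoset (n : ℕ) : Set₁ where
  field
    _≼_            : Fin n → Fin n → Set
    isPartialOrder : IsPartialOrder _≡_ _≼_

  _≺_ : Fin n → Fin n → Set
  x ≺ y = x ≼ y × x ≢ y

module _ {n : ℕ} (P : FinPoset n) where
  open FinPoset P

  Comparable : Fin n → Fin n → Set
  Comparable x y = (x ≼ y) Data.Sum.⊎ (y ≼ x)
    where import Data.Sum

  IsAntichain : Subset n → Set
  IsAntichain B = ∀ x y → x ∈ B → y ∈ B → x ≢ y → ¬ (x ≼ y)

  IsOrderAutonomous : Subset n → Set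
  IsOrderAutonomous B =
    (∃ λ b → b ∈ B) ×
    (∀ z → z ∉ B →
       (∀ b b′ → b ∈ B → b′ ∈ B → z ≺ b → z ≺ b′) ×
       (∀ b b′ → b ∈ B → b′ ∈ B → b ≺ z → b′ ≺ z))

  IsNontrivial : Subset n → Set
  IsNontrivial B = (∣ B ∣ ≢ 1) × (∣ B ∣ ≢ n)

  IsAutomorphism : (Fin n → Fin n) → Set
  IsAutomorphism f =
    (∀ x y → f x ≡ f y → x ≡ y) × (∀ y → ∃ λ x → f x ≡ y) ×
    (∀ x y → x ≼ y → f x ≼ f y) × (∀ x y → f x ≼ f y → x ≼ y)

  MapsOnto : (Fin n → Fin n) → Subset n → Set
  MapsOnto f A = (∀ x → x ∈ A → f x ∈ A) × (∀ y → y ∈ A → ∃ λ x → x ∈ A × f x ≡ y)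

{-# OPTIONS --safe #-}
-- Let x ∈ A with Φ x ≠ Ψ x. Every point z outside A is z = Φ w = Ψ w for some
-- w outside A, so z is below (above) Φ x iff w is below (above) x iff z is
-- below (above) Ψ x. Points of A other than Φ x, Ψ x are incomparable to both,
-- A being an antichain. Hence {Φ x, Ψ x} is an order-autonomous antichain
-- inside A with two elements, which is nontrivial since |P| ≥ 3.
module Submission where

open import Defs
open import Data.Nat using (ℕ; _≤_; _<_; _+_; s≤s; z≤n)
open import Data.Nat.Properties
  using (≤-trans; ≤-reflexive; <-≤-trans; <⇒≢; >⇒≢; +-suc; +-monoʳ-≤; n≤1+n)
open import Data.Fin using (Fin)
open import Data.Fin.Properties using (_≟_)
open import Data.Fin.Subset using (Subset; _∈_; _∉_; _⊆_; ⁅_⁆; _∪_; ∣_∣; inside; outside)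
open import Data.Fin.Subset.Properties
  using (_∈?_; p⊆p∪q; q⊆p∪q; x∈p∪q⁻; x∈⁅x⁆; x∈⁅y⁆⇒x≡y; ∣⁅x⁆∣≡1; p⊂q⇒∣p∣<∣q∣)
open import Data.Vec using ([]; _∷_)
open import Data.Product using (∃; _×_; _,_; proj₁; proj₂)
open import Data.Sum using (_⊎_; inj₁; inj₂)
open import Data.Empty using (⊥-elim)
open import Function using (_⇔_; mk⇔; Equivalence)
open import Relation.Binary.PropositionalEquality using (_≡_; _≢_; refl; sym; subst; subst₂)
open import Relation.Nullary using (¬_; yes; no)

∣p∪q∣≤∣p∣+∣q∣ : ∀ {n} (p q : Subset n) → ∣ p ∪ q ∣ ≤ ∣ p ∣ + ∣ q ∣
∣p∪q∣≤∣p∣+∣q∣ []            []            = z≤n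
∣p∪q∣≤∣p∣+∣q∣ (outside ∷ p) (outside ∷ q) = ∣p∪q∣≤∣p∣+∣q∣ p q
∣p∪q∣≤∣p∣+∣q∣ (outside ∷ p) (inside ∷ q)  =
  ≤-trans (s≤s (∣p∪q∣≤∣p∣+∣q∣ p q)) (≤-reflexive (sym (+-suc ∣ p ∣ ∣ q ∣)))
∣p∪q∣≤∣p∣+∣q∣ (inside ∷ p)  (outside ∷ q) = s≤s (∣p∪q∣≤∣p∣+∣q∣ p q)
∣p∪q∣≤∣p∣+∣q∣ (inside ∷ p)  (inside ∷ q)  =
  s≤s (≤-trans (∣p∪q∣≤∣p∣+∣q∣ p q) (+-monoʳ-≤ ∣ p ∣ (n≤1+n ∣ q ∣)))

module _ {n : ℕ} {b c : Fin n} where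

  ∈-pair⁻ : ∀ {u} → u ∈ ⁅ b ⁆ ∪ ⁅ c ⁆ → u ≡ b ⊎ u ≡ c
  ∈-pair⁻ u∈ with x∈p∪q⁻ ⁅ b ⁆ ⁅ c ⁆ u∈
  ... | inj₁ u∈⁅b⁆ = inj₁ (x∈⁅y⁆⇒x≡y b u∈⁅b⁆)
  ... | inj₂ u∈⁅c⁆ = inj₂ (x∈⁅y⁆⇒x≡y c u∈⁅c⁆)

  pair-⊆ : ∀ {A : Subset n} → b ∈ A → c ∈ A → ⁅ b ⁆ ∪ ⁅ c ⁆ ⊆ A
  pair-⊆ b∈A c∈A u∈ with ∈-pair⁻ u∈
  ... | inj₁ refl = b∈A
  ... | inj₂ refl = c∈A

  pair-constant : ∀ {ℓ} (Q : Fin n → Set ℓ) → Q b ⇔ Q c →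
    ∀ {u u′} → u ∈ ⁅ b ⁆ ∪ ⁅ c ⁆ → u′ ∈ ⁅ b ⁆ ∪ ⁅ c ⁆ → Q u → Q u′
  pair-constant Q Qb⇔Qc u∈ u′∈ with ∈-pair⁻ u∈ | ∈-pair⁻ u′∈
  ... | inj₁ refl | inj₁ refl = λ Qu → Qu
  ... | inj₂ refl | inj₂ refl = λ Qu → Qu
  ... | inj₁ refl | inj₂ refl = Equivalence.to Qb⇔Qc
  ... | inj₂ refl | inj₁ refl = Equivalence.from Qb⇔Qc

  1<∣pair∣ : b ≢ c → 1 < ∣ ⁅ b ⁆ ∪ ⁅ c ⁆ ∣
  1<∣pair∣ b≢c = subst (_< ∣ ⁅ b ⁆ ∪ ⁅ c ⁆ ∣) (∣⁅x⁆∣≡1 b)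
    (p⊂q⇒∣p∣<∣q∣ (p⊆p∪q ⁅ c ⁆ , c , q⊆p∪q ⁅ b ⁆ ⁅ c ⁆ (x∈⁅x⁆ c) ,
                  λ c∈⁅b⁆ → b≢c (sym (x∈⁅y⁆⇒x≡y b c∈⁅b⁆))))

  ∣pair∣≤2 : ∣ ⁅ b ⁆ ∪ ⁅ c ⁆ ∣ ≤ 2
  ∣pair∣≤2 = subst₂ (λ i j → ∣ ⁅ b ⁆ ∪ ⁅ c ⁆ ∣ ≤ i + j) (∣⁅x⁆∣≡1 b) (∣⁅x⁆∣≡1 c)
    (∣p∪q∣≤∣p∣+∣q∣ ⁅ b ⁆ ⁅ c ⁆)

module _ {n : ℕ} (P : FinPoset n) where
  open FinPoset P

  pair-nontrivial : 3 ≤ n → {b c : Fin n} → b ≢ c → IsNontrivial P (⁅ b ⁆ ∪ ⁅ c ⁆)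
  pair-nontrivial 3≤n {b} {c} b≢c = >⇒≢ (1<∣pair∣ b≢c) , <⇒≢ (<-≤-trans (s≤s (∣pair∣≤2 {b = b} {c = c})) 3≤n)

  antichain-⊆ : ∀ {A B} → B ⊆ A → IsAntichain P A → IsAntichain P B
  antichain-⊆ B⊆A antiA x y x∈B y∈B = antiA x y (B⊆A x∈B) (B⊆A y∈B)

  -- Inside an antichain A, only the points outside A can tell elements of B apart.
  autonomous-if-uniform-outside : ∀ {A B} → IsAntichain P A → B ⊆ A → (∃ λ b → b ∈ B) →
    (∀ z {u u′} → z ∉ A → u ∈ B → u′ ∈ B → z ≼ u → z ≼ u′) →
    (∀ z {u u′} → z ∉ A → u ∈ B → u′ ∈ B → u ≼ z → u′ ≼ z) →
    IsOrderAutonomous P B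
  autonomous-if-uniform-outside {A} antiA B⊆A nonempty below above =
    nonempty , λ z z∉B → strictly-below z z∉B , strictly-above z z∉B
    where
    strictly-below : ∀ z → z ∉ _ → ∀ u u′ → u ∈ _ → u′ ∈ _ → z ≺ u → z ≺ u′
    strictly-below z z∉B u u′ u∈B u′∈B (z≼u , z≢u) with z ∈? A
    ... | yes z∈A = ⊥-elim (antiA z u z∈A (B⊆A u∈B) z≢u z≼u)
    ... | no z∉A  = below z z∉A u∈B u′∈B z≼u , λ { refl → z∉B u′∈B }
    strictly-above : ∀ z → z ∉ _ → ∀ u u′ → u ∈ _ → u′ ∈ _ → u ≺ z → u′ ≺ z
    strictly-above z z∉B u u′ u∈B u′∈B (u≼z , u≢z) with z ∈? A
    ... | yes z∈A = ⊥-elim (antiA u z (B⊆A u∈B) z∈A u≢z u≼z)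
    ... | no z∉A  = above z z∉A u∈B u′∈B u≼z , λ { refl → z∉B u′∈B }

  module _ {A : Subset n} {F G : Fin n → Fin n}
           (autF : IsAutomorphism P F) (autG : IsAutomorphism P G)
           (F[A]⊆A : ∀ x → x ∈ A → F x ∈ A) (agree : ∀ w → w ∉ A → F w ≡ G w) where

    private
      surjectiveF : ∀ y → ∃ λ x → F x ≡ y
      surjectiveF = proj₁ (proj₂ autF)
      reflectsF : ∀ x y → F x ≼ F y → x ≼ y
      reflectsF = proj₂ (proj₂ (proj₂ autF))
      preservesG : ∀ x y → x ≼ y → G x ≼ G y
      preservesG = proj₁ (proj₂ (proj₂ autG))

    ∉-preimage : ∀ {z} → z ∉ A → ∃ λ w → w ∉ A × F w ≡ z
    ∉-preimage {z} z∉A with surjectiveF z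
    ... | w , refl = w , (λ w∈A → z∉A (F[A]⊆A w w∈A)) , refl

    ≼-image-transfer : ∀ {z} x → z ∉ A → z ≼ F x → z ≼ G x
    ≼-image-transfer x z∉A z≼Fx with ∉-preimage z∉A
    ... | w , w∉A , refl =
      subst (_≼ G x) (sym (agree w w∉A)) (preservesG w x (reflectsF w x z≼Fx))

    ≽-image-transfer : ∀ {z} x → z ∉ A → F x ≼ z → G x ≼ z
    ≽-image-transfer x z∉A Fx≼z with ∉-preimage z∉A
    ... | w , w∉A , refl =
      subst (G x ≼_) (sym (agree w w∉A)) (preservesG x w (reflectsF x w Fx≼z))

lemma2p1 : (n : ℕ) → 3 ≤ n → (P : FinPoset n) → (A : Subset n) →
    IsAntichain P A →
    (∀ B → B ⊆ A → IsAntichain P B → IsOrderAutonomous P B → ¬ IsNontrivial P B) →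
    (Φ Ψ : Fin n → Fin n) → IsAutomorphism P Φ → IsAutomorphism P Ψ →
    MapsOnto P Φ A → MapsOnto P Ψ A →
    (∀ x → x ∉ A → Φ x ≡ Ψ x) →
    ∀ x → Φ x ≡ Ψ x
lemma2p1 n 3≤n P A antiA noAutonomous Φ Ψ autΦ autΨ (Φ[A]⊆A , _) (Ψ[A]⊆A , _) agree x
  with x ∈? A | Φ x ≟ Ψ x
... | no x∉A | _        = agree x x∉A
... | yes _  | yes Φx≡Ψx = Φx≡Ψx
... | yes x∈A | no Φx≢Ψx =
  ⊥-elim (noAutonomous B B⊆A (antichain-⊆ P B⊆A antiA) autonomous (pair-nontrivial P 3≤n Φx≢Ψx))
  where
  open FinPoset P
  B : Subset n
  B = ⁅ Φ x ⁆ ∪ ⁅ Ψ x ⁆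
  B⊆A : B ⊆ A
  B⊆A = pair-⊆ (Φ[A]⊆A x x∈A) (Ψ[A]⊆A x x∈A)
  agree′ : ∀ w → w ∉ A → Ψ w ≡ Φ w
  agree′ w w∉A = sym (agree w w∉A)
  autonomous : IsOrderAutonomous P B
  autonomous = autonomous-if-uniform-outside P antiA B⊆A (Φ x , p⊆p∪q ⁅ Ψ x ⁆ (x∈⁅x⁆ (Φ x)))
    (λ z z∉A → pair-constant (z ≼_) (mk⇔
      (≼-image-transfer P autΦ autΨ Φ[A]⊆A agree x z∉A)
      (≼-image-transfer P autΨ autΦ Ψ[A]⊆A agree′ x z∉A)))
    (λ z z∉A → pair-constant (_≼ z) (mk⇔
      (≽-image-transfer P autΦ autΨ Φ[A]⊆A agree x z∉A)
      (≽-image-transfer P autΨ autΦ Ψ[A]⊆A agree′ x z∉A)))
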